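{- Let $k$ be a positive integer, $0<\varepsilon<1$, and let $f:\{0,1\}^n\to\{\pm1\}$ be $\varepsilon$-far from every $k$-junta. Order the variables by influence, i.e. let $I_1\ge I_2\ge\cdots\ge I_n$ be the values $\mathrm{Inf}_1(f),\dots,\mathrm{Inf}_n(f)$ sorted in non-increasing order, and set $I_j=0$ for $j>n$. Then at least one of the following holds: (1) $\sum_{j=k+1}^{200k}I_j\ge\varepsilon/2$ and there exists $\ell\in\{0,1,\dots,\lfloor\log(200k)\rfloor\}$ such that $\big|\{j\in[n]:\ \mathrm{Inf}_j(f)\ge \varepsilon/(2^{\ell+3}\log(400k))\}\big|\ge k+2^{\ell}$; (2) $\sum_{j=k+1}^{200k}I_j\le\varepsilon/2$.
   Context: Logarithms $\log$ are base 2. For $f:\{0,1\}^n\to\mathbb R$ and $T\subseteq[n]$, $\hat f(T)=2^{ -n}\sum_x f(x)(-1)^{\sum_{j\in T}x_j}$, and for $S\subseteq[n]$, $\mathrm{Inf}_S(f)=\sum_{T:\,T\cap S\neq\emptyset}\hat f(T)^2$; $\mathrm{Inf}_j(f)=\mathrm{Inf}_{\{j\}}(f)$. A $k$-junta is a function depending on at most $k$ of its input bits; $f$ is $\varepsilon$-far from every $k$-junta if it differs from each $k$-junta on at least $\varepsilon2^n$ inputs.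
   Formalization: The parameter ε is rational rather than real. -}

module Defs where

open import Data.Bool using (Bool; true; false; _∧_; _∨_; not; if_then_else_)
open import Data.Nat as ℕ using (ℕ; zero; suc; _∸_)
open import Data.Integer using (+_)
open import Data.Rational using (ℚ; 0ℚ; 1ℚ; -_; _+_; _*_; _/_; _≤_; _<_; _≥_)
open import Data.Rational.Properties using (_≟_; _≤?_)
open import Data.Fin using (Fin)
open import Data.Vec using (Vec; []; _∷_; lookup; zipWith; count)
open import Data.List using (List; []; _∷_; map; _++_; length; filter; filterᵇ; applyUpTo)
open import Data.Product using (Σ; ∃; _×_)
open import Relation.Nullary using (¬?)
open import Relation.Binary.PropositionalEquality using (_≡_)
open import Data.Fin.Subset using (Subset; _∈_; ∣_∣; ⁅_⁆)

-- Points of the cube {0,1}^n : x : Vec Bool n, coordinate j is 1 iff lookup x j ≡ true.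
Cube : ℕ → Set
Cube n = Vec Bool n

allCube : (n : ℕ) → List (Cube n)
allCube zero = [] ∷ []
allCube (suc n) = map (false ∷_) (allCube n) ++ map (true ∷_) (allCube n)

sumℚ : List ℚ → ℚ
sumℚ [] = 0ℚ
sumℚ (q ∷ qs) = q + sumℚ qs

ℕtoℚ : ℕ → ℚ
ℕtoℚ m = (+ m) / 1

signPow : ℕ → ℚ
signPow zero = 1ℚ
signPow (suc m) = - signPow m

χ : ∀ {n} → Subset n → Cube n → ℚ
χ T x = signPow (count (λ b → b Data.Bool.≟ true) (zipWith _∧_ T x))

invPow2 : ℕ → ℚ
invPow2 zero = 1ℚ
invPow2 (suc m) = ((+ 1) / 2) * invPow2 m

fhat : ∀ {n} → (Cube n → ℚ) → Subset n → ℚ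
fhat {n} f T = invPow2 n * sumℚ (map (λ x → f x * χ T x) (allCube n))

meets : ∀ {n} → Subset n → Subset n → Bool
meets [] [] = false
meets (a ∷ T) (b ∷ S) = (a ∧ b) ∨ meets T S

InfSet : ∀ {n} → (Cube n → ℚ) → Subset n → ℚ
InfSet {n} f S = sumℚ (map (λ T → fhat f T * fhat f T) (filterᵇ (meets S) (allCube n)))

Inf : ∀ {n} → (Cube n → ℚ) → Fin n → ℚ
Inf f j = InfSet f ⁅ j ⁆

IsJunta : ∀ {n} → ℕ → (Cube n → ℚ) → Set
IsJunta {n} k g = Σ (Subset n) λ J → (∣ J ∣ ℕ.≤ k) ×
  (∀ x y → (∀ i → i ∈ J → lookup x i ≡ lookup y i) → g x ≡ g y)

distCount : ∀ {n} → (Cube n → ℚ) → (Cube n → ℚ) → ℕ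
distCount {n} f g = length (filter (λ x → ¬? (f x ≟ g x)) (allCube n))

FarFromJuntas : ∀ {n} → ℚ → ℕ → (Cube n → ℚ) → Set
FarFromJuntas {n} ε k f = ∀ g → IsJunta k g → ε * ℕtoℚ (2 ℕ.^ n) ≤ ℕtoℚ (distCount f g)

-- I_j for 1-indexed j, from a list I_1, I_2, ...; I_j = 0 beyond the list (and for j = 0).
Ith : List ℚ → ℕ → ℚ
Ith [] j = 0ℚ
Ith (q ∷ qs) zero = 0ℚ
Ith (q ∷ qs) (suc zero) = q
Ith (q ∷ qs) (suc (suc j)) = Ith qs (suc j)

sumFromTo : ℕ → ℕ → (ℕ → ℚ) → ℚ
sumFromTo a b F = sumℚ (applyUpTo (λ i → F (a ℕ.+ i)) (suc b ∸ a))

-- "c · log₂ N ≥ e", for rationals c ≥ 0, e and N ≥ 1 (no reals in agda-stdlib):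
-- log₂ N ≥ t  iff  every nonnegative rational p/q with p/q ≤ t satisfies 2^p ≤ N^q.
-- Here the condition p/q ≤ e/c is written (p/q)·c ≤ e (which is also correct when c = 0).
MulLogGe : ℚ → ℕ → ℚ → Set
MulLogGe c N e = ∀ (p q : ℕ) → ((+ p) / suc q) * c ≤ e → 2 ℕ.^ p ℕ.≤ N ℕ.^ suc q

-- Inf_j(f) ≥ ε / (2^{ℓ+3} log₂ N), written as Inf_j(f) · 2^{ℓ+3} · log₂ N ≥ ε
-- (equivalent, since 2^{ℓ+3} log₂ N > 0 for N ≥ 2).
InfAboveThreshold : ℚ → ℕ → ℕ → ℚ → Set
InfAboveThreshold x ℓ N ε = MulLogGe (x * ℕtoℚ (2 ℕ.^ (ℓ ℕ.+ 3))) N ε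

module Submission where

open import Defs
open import Data.Nat using (ℕ; _+_; _*_; _^_; _≤_; _<_)
open import Data.Nat.Logarithm using (⌊log₂_⌋)
open import Data.Integer using (+_)
open import Data.Rational using (ℚ; 0ℚ; 1ℚ; -_; _/_) renaming (_*_ to _*ℚ_; _≤_ to _≤ℚ_; _<_ to _<ℚ_; _≥_ to _≥ℚ_)
open import Data.Fin.Subset using (Subset; _∈_; ∣_∣)
open import Data.List using (List; map; allFin)
open import Data.List.Relation.Binary.Permutation.Propositional using (_↭_)
open import Data.List.Relation.Unary.Linked using (Linked)
open import Data.Product using (Σ; _×_)
open import Data.Sum using (_⊎_)
open import Relation.Binary.PropositionalEquality using (_≡_)

open import Data.Nat as ℕ using (zero; suc; _∸_; z≤n; s≤s)
import Data.Nat.Properties as ℕ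
open import Data.Nat.Logarithm using (⌊log₂⌋-mono-≤; ⌊log₂⌊n/2⌋⌋≡⌊log₂n⌋∸1; ⌊log₂[2^n]⌋≡n)
import Data.Integer as ℤ
import Data.Integer.Properties as ℤ
open import Data.Rational as ℚ using (toℚᵘ)
import Data.Rational.Properties as ℚ
open import Data.Rational.Unnormalised as ℚᵘ using (mkℚᵘ; *≡*; _≃_)
import Data.Rational.Unnormalised.Properties as ℚᵘ
open import Data.Fin as Fin using (Fin)
open import Data.Fin.Subset using (⁅_⁆)
import Data.Vec as Vec
import Data.Vec.Properties as Vec
open import Data.List using ([]; _∷_; length; filter; filterᵇ; tabulate; applyUpTo)
import Data.List.Properties as List
open import Data.List.Relation.Unary.All as All using (All; []; _∷_)
import Data.List.Relation.Unary.All.Properties as All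
open import Data.List.Relation.Unary.Linked as Linked using ([]; [-]; _∷_)
open import Data.List.Relation.Binary.Permutation.Propositional using (↭-sym)
open import Data.List.Relation.Binary.Permutation.Propositional.Properties using (All-resp-↭; ↭-length; filter-↭)
open import Data.Bool.Properties using (T-≡)
open import Data.Empty using (⊥-elim)
open import Data.Maybe using (nothing)
open import Data.Product using (_,_)
open import Data.Sum as Sum using (inj₁; inj₂)
open import Function using (id; _∘_; Equivalence)
open import Level using (0ℓ)
open import Relation.Unary using (Pred; Decidable)
open import Relation.Nullary using (Dec; yes; no)
open import Relation.Nullary.Decidable using (does; toWitness; isYes≗does)
open import Relation.Binary.PropositionalEquality using (module ≡-Reasoning; refl; sym; trans; cong; cong₂; subst; subst₂)
open import Tactic.RingSolver using (solve-∀)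
open import Tactic.RingSolver.Core.AlmostCommutativeRing using (AlmostCommutativeRing; fromCommutativeRing)

-- Lemma 4.3 is a pigeonhole statement about the sorted influences I_1 ≥ I_2 ≥ ⋯ ≥ 0.
-- Put M = ⌊log₂ 200k⌋ + 1, so that 200k < 2^M ≤ 400k, and cut the indices k+1, k+2, …
-- into dyadic blocks of sizes 1, 2, 4, …; block ℓ starts at I_{k+2^ℓ} and, the sequence
-- being nonincreasing, sums to at most 2^ℓ · I_{k+2^ℓ}.  Block ℓ is "heavy" when
-- ε ≤ 2^ℓ · I_{k+2^ℓ} · 8M.  If no block ℓ < M is heavy, the M blocks (which cover
-- I_{k+1}, …, I_{200k}) sum to less than M · ε/(8M) ≤ ε/2.  If block ℓ is heavy, the set
-- J of variables with influence ≥ I_{k+2^ℓ} has at least k + 2^ℓ elements, and each of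
-- them satisfies Inf_j · 2^(ℓ+3) · M ≥ ε, which certifies Inf_j · 2^(ℓ+3) · log₂(400k) ≥ ε
-- because 2^M ≤ 400k.

ℕtoℚ-toℚᵘ : ∀ m → toℚᵘ (ℕtoℚ m) ≃ mkℚᵘ (+ m) 0
ℕtoℚ-toℚᵘ m = ℚ.toℚᵘ-fromℚᵘ (mkℚᵘ (+ m) 0)

ℕtoℚ-nonNeg : ∀ m → 0ℚ ≤ℚ ℕtoℚ m
ℕtoℚ-nonNeg m = ℚ.toℚᵘ-cancel-≤ (ℚᵘ.≤-respʳ-≃ (ℚᵘ.≃-sym (ℕtoℚ-toℚᵘ m)) (ℚᵘ.nonNegative⁻¹ (mkℚᵘ (+ m) 0)))

ℕtoℚ-pos : ∀ m → 0ℚ <ℚ ℕtoℚ (suc m)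
ℕtoℚ-pos m = ℚ.toℚᵘ-cancel-< (ℚᵘ.<-respʳ-≃ (ℚᵘ.≃-sym (ℕtoℚ-toℚᵘ (suc m))) (ℚᵘ.positive⁻¹ (mkℚᵘ (+ suc m) 0)))

frac≤ℕtoℚ : ∀ p q M → (+ p) / suc q ≤ℚ ℕtoℚ M → p ≤ M * suc q
frac≤ℕtoℚ p q M le = ℕ.≤-trans (ℕ.≤-reflexive (sym (ℕ.*-identityʳ p)))
    (ℤ.drop‿+≤+ (subst₂ ℤ._≤_ (sym (ℤ.pos-* p 1)) (sym (ℤ.pos-* M (suc q))) cross))
  where
  cross : + p ℤ.* + 1 ℤ.≤ + M ℤ.* + suc q
  cross = ℚᵘ.drop-*≤* (ℚᵘ.≤-respʳ-≃ (ℕtoℚ-toℚᵘ M)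
    (ℚᵘ.≤-respˡ-≃ (ℚ.toℚᵘ-fromℚᵘ (mkℚᵘ (+ p) q)) (ℚ.toℚᵘ-mono-≤ le)))

ℕtoℚ-+ : ∀ a b → ℕtoℚ (a + b) ≡ ℕtoℚ a ℚ.+ ℕtoℚ b
ℕtoℚ-+ a b = ℚ.toℚᵘ-injective (begin
  toℚᵘ (ℕtoℚ (a + b))                      ≈⟨ ℕtoℚ-toℚᵘ (a + b) ⟩
  mkℚᵘ (+ (a + b)) 0                       ≈⟨ *≡* numerators ⟩
  mkℚᵘ (+ a) 0 ℚᵘ.+ mkℚᵘ (+ b) 0           ≈⟨ ℚᵘ.+-cong (ℚᵘ.≃-sym (ℕtoℚ-toℚᵘ a)) (ℚᵘ.≃-sym (ℕtoℚ-toℚᵘ b)) ⟩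
  toℚᵘ (ℕtoℚ a) ℚᵘ.+ toℚᵘ (ℕtoℚ b)         ≈⟨ ℚᵘ.≃-sym (ℚ.toℚᵘ-homo-+ (ℕtoℚ a) (ℕtoℚ b)) ⟩
  toℚᵘ (ℕtoℚ a ℚ.+ ℕtoℚ b)                 ∎)
  where
  open ℚᵘ.≃-Reasoning
  numerators : + (a + b) ℤ.* + 1 ≡ (+ a ℤ.* + 1 ℤ.+ + b ℤ.* + 1) ℤ.* + 1
  numerators = cong (ℤ._* + 1) (trans (ℤ.pos-+ a b)
    (sym (cong₂ ℤ._+_ (ℤ.*-identityʳ (+ a)) (ℤ.*-identityʳ (+ b)))))

ℕtoℚ-* : ∀ a b → ℕtoℚ (a * b) ≡ ℕtoℚ a *ℚ ℕtoℚ b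
ℕtoℚ-* a b = ℚ.toℚᵘ-injective (begin
  toℚᵘ (ℕtoℚ (a * b))                      ≈⟨ ℕtoℚ-toℚᵘ (a * b) ⟩
  mkℚᵘ (+ (a * b)) 0                       ≈⟨ *≡* (cong (ℤ._* + 1) (ℤ.pos-* a b)) ⟩
  mkℚᵘ (+ a) 0 ℚᵘ.* mkℚᵘ (+ b) 0           ≈⟨ ℚᵘ.*-cong (ℚᵘ.≃-sym (ℕtoℚ-toℚᵘ a)) (ℚᵘ.≃-sym (ℕtoℚ-toℚᵘ b)) ⟩
  toℚᵘ (ℕtoℚ a) ℚᵘ.* toℚᵘ (ℕtoℚ b)         ≈⟨ ℚᵘ.≃-sym (ℚ.toℚᵘ-homo-* (ℕtoℚ a) (ℕtoℚ b)) ⟩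
  toℚᵘ (ℕtoℚ a *ℚ ℕtoℚ b)                  ∎)
  where open ℚᵘ.≃-Reasoning

suc-times : ∀ r c → c ℚ.+ ℕtoℚ r *ℚ c ≡ ℕtoℚ (suc r) *ℚ c
suc-times r c = begin
  c ℚ.+ ℕtoℚ r *ℚ c           ≡⟨ cong (ℚ._+ ℕtoℚ r *ℚ c) (ℚ.*-identityˡ c) ⟨
  1ℚ *ℚ c ℚ.+ ℕtoℚ r *ℚ c     ≡⟨ ℚ.*-distribʳ-+ c 1ℚ (ℕtoℚ r) ⟨
  (1ℚ ℚ.+ ℕtoℚ r) *ℚ c        ≡⟨ cong (_*ℚ c) (ℕtoℚ-+ 1 r) ⟨
  ℕtoℚ (suc r) *ℚ c           ∎
  where open ≡-Reasoning

twice-half≤ : ∀ n → 2 * ℕ.⌊ n /2⌋ ≤ n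
twice-half≤ n = ℕ.≤-trans
  (ℕ.+-monoʳ-≤ (ℕ.⌊ n /2⌋) (ℕ.≤-trans (ℕ.≤-reflexive (ℕ.+-identityʳ _)) (ℕ.⌊n/2⌋≤⌈n/2⌉ n)))
  (ℕ.≤-reflexive (ℕ.⌊n/2⌋+⌈n/2⌉≡n n))

pow-⌊log₂⌋≤ : ∀ L M → ⌊log₂ M ⌋ ≡ L → 1 ≤ M → 2 ^ L ≤ M
pow-⌊log₂⌋≤ zero    M             _  1≤M = 1≤M
pow-⌊log₂⌋≤ (suc L) (suc zero)    ()  _
pow-⌊log₂⌋≤ (suc L) (suc (suc m)) eq _  =
  ℕ.≤-trans (ℕ.*-monoʳ-≤ 2 halfBound) (twice-half≤ (suc (suc m)))
  where
  halfBound : 2 ^ L ≤ ℕ.⌊ suc (suc m) /2⌋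
  halfBound = pow-⌊log₂⌋≤ L _ (trans (⌊log₂⌊n/2⌋⌋≡⌊log₂n⌋∸1 (suc (suc m))) (cong (ℕ._∸ 1) eq)) (s≤s z≤n)

log₂-lower : ∀ M → 1 ≤ M → 2 ^ ⌊log₂ M ⌋ ≤ M
log₂-lower M = pow-⌊log₂⌋≤ ⌊log₂ M ⌋ M refl

log₂-upper : ∀ M → M < 2 ^ suc ⌊log₂ M ⌋
log₂-upper M = ℕ.≰⇒> λ big → ℕ.<-irrefl refl (ℕ.≤-trans
  (ℕ.≤-reflexive (sym (⌊log₂[2^n]⌋≡n (suc ⌊log₂ M ⌋)))) (⌊log₂⌋-mono-≤ big))

Ith-nonNeg : ∀ {xs} → All (0ℚ ≤ℚ_) xs → ∀ j → 0ℚ ≤ℚ Ith xs j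
Ith-nonNeg []       _             = ℚ.≤-refl
Ith-nonNeg (_ ∷ _)  zero          = ℚ.≤-refl
Ith-nonNeg (x≥0 ∷ _) (suc zero)   = x≥0
Ith-nonNeg (_ ∷ xs≥0) (suc (suc j)) = Ith-nonNeg xs≥0 (suc j)

-- One step down the list; past the last entry the value 0 is below every entry.
Ith-step : ∀ {xs} → Linked _≥ℚ_ xs → All (0ℚ ≤ℚ_) xs → ∀ i → Ith xs (suc (suc i)) ≤ℚ Ith xs (suc i)
Ith-step []          _              _       = ℚ.≤-refl
Ith-step [-]         (x≥0 ∷ [])     zero    = x≥0
Ith-step [-]         _              (suc i) = ℚ.≤-refl
Ith-step (y≤x ∷ _)   _              zero    = y≤x
Ith-step (_ ∷ sorted) (_ ∷ xs≥0)    (suc i) = Ith-step sorted xs≥0 i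

Ith-antitone : ∀ {xs} → Linked _≥ℚ_ xs → All (0ℚ ≤ℚ_) xs →
               ∀ {i j} → i ≤ j → Ith xs (suc j) ≤ℚ Ith xs (suc i)
Ith-antitone {xs} sorted xs≥0 i≤j = go (ℕ.≤⇒≤′ i≤j)
  where
  go : ∀ {i j} → i ℕ.≤′ j → Ith xs (suc j) ≤ℚ Ith xs (suc i)
  go ℕ.≤′-refl        = ℚ.≤-refl
  go (ℕ.≤′-step i≤′j) = ℚ.≤-trans (Ith-step sorted xs≥0 _) (go i≤′j)

-- If the i-th largest entry is at least t > 0, then at least i entries are ≥ t.
-- (Stated for any decision procedure for t ≤_, so that it can be case-split on.)
count-above : ∀ {t} (t≤? : ∀ x → Dec (t ≤ℚ x)) xs i → Linked _≥ℚ_ xs → All (0ℚ ≤ℚ_) xs →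
              0ℚ <ℚ t → t ≤ℚ Ith xs i → i ≤ length (filter t≤? xs)
count-above t≤? xs       zero    _      _ _ _ = z≤n
count-above t≤? []       (suc r) _      _ t>0 t≤0 = ⊥-elim (ℚ.<-irrefl refl (ℚ.<-≤-trans t>0 t≤0))
count-above t≤? (x ∷ xs) (suc r) sorted (x≥0 ∷ xs≥0) t>0 t≤xᵣ with t≤? x
... | no t≰x = ⊥-elim (t≰x (ℚ.≤-trans t≤xᵣ (Ith-antitone sorted (x≥0 ∷ xs≥0) {j = r} z≤n)))
count-above t≤? (x ∷ xs) (suc zero)    sorted _ _ _ | yes _ = s≤s z≤n
count-above t≤? (x ∷ xs) (suc (suc r)) sorted (_ ∷ xs≥0) t>0 t≤xᵣ | yes _ =
  s≤s (count-above t≤? xs (suc r) (Linked.tail sorted) xs≥0 t>0 t≤xᵣ)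

subsetWhere : ∀ {n p} {P : Pred (Fin n) p} → Decidable P → Subset n
subsetWhere P? = Vec.tabulate (λ j → does (P? j))

∈-subsetWhere : ∀ {n p} {P : Pred (Fin n) p} (P? : Decidable P) {j} → j ∈ subsetWhere P? → P j
∈-subsetWhere P? {j} j∈ = toWitness {a? = P? j} (Equivalence.from T-≡
  (trans (isYes≗does (P? j)) (trans (sym (Vec.lookup∘tabulate (λ i → does (P? i)) j)) (Vec.[]=⇒lookup j∈))))

∣subsetWhere∣ : ∀ {a q} {A : Set a} {Q : Pred A q} (Q? : Decidable Q) n (g : Fin n → A) →
                ∣ subsetWhere (λ j → Q? (g j)) ∣ ≡ length (filter Q? (map g (allFin n)))
∣subsetWhere∣ Q? n g = trans (count-tabulate n g) (cong (λ xs → length (filter Q? xs)) (sym (List.map-tabulate id g)))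
  where
  count-tabulate : ∀ n (g : Fin n → _) →
                   ∣ subsetWhere (λ j → Q? (g j)) ∣ ≡ length (filter Q? (tabulate g))
  count-tabulate zero    g = refl
  count-tabulate (suc n) g with Q? (g Fin.zero)
  ... | yes _ = cong suc (count-tabulate n (g ∘ Fin.suc))
  ... | no  _ = count-tabulate n (g ∘ Fin.suc)

-- Partial sums G 0 + ⋯ + G (a-1).  Note sumFromTo a b F = partialSum (λ i → F (a + i)) (b + 1 ∸ a).
partialSum : (ℕ → ℚ) → ℕ → ℚ
partialSum G a = sumℚ (applyUpTo G a)

partialSum-split : ∀ G a b → partialSum G (a + b) ≡ partialSum G a ℚ.+ partialSum (λ i → G (a + i)) b
partialSum-split G zero    b = sym (ℚ.+-identityˡ _)
partialSum-split G (suc a) b = trans (cong (G 0 ℚ.+_) (partialSum-split (G ∘ suc) a b)) (sym (ℚ.+-assoc (G 0) _ _))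

partialSum-nonNeg : ∀ G → (∀ i → 0ℚ ≤ℚ G i) → ∀ a → 0ℚ ≤ℚ partialSum G a
partialSum-nonNeg G G≥0 zero    = ℚ.≤-refl
partialSum-nonNeg G G≥0 (suc a) = ℚ.+-mono-≤ (G≥0 0) (partialSum-nonNeg (G ∘ suc) (G≥0 ∘ suc) a)

partialSum-mono : ∀ G → (∀ i → 0ℚ ≤ℚ G i) → ∀ {a b} → a ≤ b → partialSum G a ≤ℚ partialSum G b
partialSum-mono G G≥0 {a} {b} a≤b = begin
  partialSum G a                                                  ≡⟨ ℚ.+-identityʳ _ ⟨
  partialSum G a ℚ.+ 0ℚ                                           ≤⟨ ℚ.+-monoʳ-≤ (partialSum G a) tail≥0 ⟩
  partialSum G a ℚ.+ partialSum (λ i → G (a + i)) (b ∸ a)          ≡⟨ partialSum-split G a (b ∸ a) ⟨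
  partialSum G (a + (b ∸ a))                                      ≡⟨ cong (partialSum G) (ℕ.m+[n∸m]≡n a≤b) ⟩
  partialSum G b                                                  ∎
  where
  open ℚ.≤-Reasoning
  tail≥0 : 0ℚ ≤ℚ partialSum (λ i → G (a + i)) (b ∸ a)
  tail≥0 = partialSum-nonNeg _ (λ i → G≥0 (a + i)) (b ∸ a)

partialSum-bound : ∀ G c → (∀ i → G i ≤ℚ c) → ∀ r → partialSum G r ≤ℚ ℕtoℚ r *ℚ c
partialSum-bound G c G≤c zero    = ℚ.≤-reflexive (sym (ℚ.*-zeroˡ c))
partialSum-bound G c G≤c (suc r) = begin
  G 0 ℚ.+ partialSum (G ∘ suc) r      ≤⟨ ℚ.+-mono-≤ (G≤c 0) (partialSum-bound (G ∘ suc) c (G≤c ∘ suc) r) ⟩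
  c ℚ.+ ℕtoℚ r *ℚ c                   ≡⟨ suc-times r c ⟩
  ℕtoℚ (suc r) *ℚ c                   ∎
  where open ℚ.≤-Reasoning

partialSum-scale : ∀ G K a → partialSum (λ i → G i *ℚ K) a ≡ partialSum G a *ℚ K
partialSum-scale G K zero    = sym (ℚ.*-zeroˡ K)
partialSum-scale G K (suc a) = trans (cong (G 0 *ℚ K ℚ.+_) (partialSum-scale (G ∘ suc) K a))
                                     (sym (ℚ.*-distribʳ-+ K (G 0) _))

-- The ℓ-th dyadic block of indices is [2^ℓ - 1, 2^(ℓ+1) - 1); it has 2^ℓ elements.
blockStart : ℕ → ℕ
blockStart ℓ = 2 ^ ℓ ∸ 1

blockStart-suc : ∀ L → blockStart (suc L) ≡ blockStart L + 2 ^ L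
blockStart-suc L = double-pred (2 ^ L) (ℕ.m^n>0 2 L)
  where
  double-pred : ∀ P → 1 ≤ P → 2 * P ∸ 1 ≡ (P ∸ 1) + P
  double-pred (suc P) _ = cong (λ m → P + m) (ℕ.+-identityʳ (suc P))

-- Dyadic decomposition of a nonincreasing sequence: the first 2^L - 1 terms split
-- into L blocks, the ℓ-th of which sums to at most 2^ℓ · G (2^ℓ - 1).
dyadic-blocks : ∀ G → (∀ {a b} → a ≤ b → G b ≤ℚ G a) → ∀ c L →
                (∀ ℓ → ℓ < L → ℕtoℚ (2 ^ ℓ) *ℚ G (blockStart ℓ) ≤ℚ c) →
                partialSum G (blockStart L) ≤ℚ ℕtoℚ L *ℚ c
dyadic-blocks G antitone c zero    _     = ℚ.≤-reflexive (sym (ℚ.*-zeroˡ c))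
dyadic-blocks G antitone c (suc L) light = begin
  partialSum G (blockStart (suc L))                         ≡⟨ cong (partialSum G) (blockStart-suc L) ⟩
  partialSum G (blockStart L + 2 ^ L)                       ≡⟨ partialSum-split G (blockStart L) (2 ^ L) ⟩
  partialSum G (blockStart L) ℚ.+ partialSum lastBlock (2 ^ L) ≤⟨ ℚ.+-mono-≤ earlierBlocks lastBlock≤c ⟩
  ℕtoℚ L *ℚ c ℚ.+ c                                         ≡⟨ ℚ.+-comm (ℕtoℚ L *ℚ c) c ⟩
  c ℚ.+ ℕtoℚ L *ℚ c                                         ≡⟨ suc-times L c ⟩
  ℕtoℚ (suc L) *ℚ c                                         ∎
  where
  open ℚ.≤-Reasoning
  lastBlock : ℕ → ℚ
  lastBlock i = G (blockStart L + i)
  earlierBlocks : partialSum G (blockStart L) ≤ℚ ℕtoℚ L *ℚ c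
  earlierBlocks = dyadic-blocks G antitone c L (λ ℓ ℓ<L → light ℓ (ℕ.m≤n⇒m≤1+n ℓ<L))
  lastBlock≤c : partialSum lastBlock (2 ^ L) ≤ℚ c
  lastBlock≤c = ℚ.≤-trans
    (partialSum-bound lastBlock (G (blockStart L)) (λ i → antitone (ℕ.m≤m+n (blockStart L) i)) (2 ^ L))
    (light L ℕ.≤-refl)

positive-factor : ∀ {e x y} → 0ℚ <ℚ e → e ≤ℚ x *ℚ y → 0ℚ ≤ℚ y → 0ℚ <ℚ x
positive-factor {e} {x} {y} e>0 e≤xy y≥0 with x ℚ.≤? 0ℚ
... | no  x≰0 = ℚ.≰⇒> x≰0
... | yes x≤0 = ⊥-elim (ℚ.<-irrefl refl (ℚ.<-≤-trans e>0 (begin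
  e          ≤⟨ e≤xy ⟩
  x *ℚ y     ≤⟨ ℚ.*-monoʳ-≤-nonNeg y {{ℚ.nonNegative y≥0}} x≤0 ⟩
  0ℚ *ℚ y    ≡⟨ ℚ.*-zeroˡ y ⟩
  0ℚ         ∎)))
  where open ℚ.≤-Reasoning

-- Certifying "c · log₂ N ≥ e" through a natural number M with 2^M ≤ N and e ≤ c · M:
-- then every rational p/(q+1) ≤ e/c is ≤ M, whence 2^p ≤ 2^(M(q+1)) ≤ N^(q+1).
mulLogGe-intro : ∀ c e M N → 0ℚ <ℚ e → e ≤ℚ c *ℚ ℕtoℚ M → 2 ^ M ≤ N → MulLogGe c N e
mulLogGe-intro c e M N e>0 e≤cM 2^M≤N p q frac·c≤e = begin
  2 ^ p              ≤⟨ ℕ.^-monoʳ-≤ 2 p≤M[q+1] ⟩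
  2 ^ (M * suc q)    ≡⟨ ℕ.^-*-assoc 2 M (suc q) ⟨
  (2 ^ M) ^ suc q    ≤⟨ ℕ.^-monoˡ-≤ (suc q) 2^M≤N ⟩
  N ^ suc q          ∎
  where
  open ℕ.≤-Reasoning
  c>0 : 0ℚ <ℚ c
  c>0 = positive-factor e>0 e≤cM (ℕtoℚ-nonNeg M)
  frac≤M : (+ p) / suc q ≤ℚ ℕtoℚ M
  frac≤M = ℚ.*-cancelʳ-≤-pos c {{ℚ.positive c>0}}
    (ℚ.≤-trans frac·c≤e (ℚ.≤-trans e≤cM (ℚ.≤-reflexive (ℚ.*-comm c (ℕtoℚ M)))))
  p≤M[q+1] : p ≤ M * suc q
  p≤M[q+1] = frac≤ℕtoℚ p q M frac≤M

eighth⇒half : ∀ {s ε m} → 0ℚ <ℚ m → 0ℚ ≤ℚ s → s *ℚ (ℕtoℚ 8 *ℚ m) ≤ℚ m *ℚ ε → s ≤ℚ ((+ 1) / 2) *ℚ ε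
eighth⇒half {s} {ε} {m} m>0 s≥0 s8m≤mε = begin
  s                                  ≡⟨ ℚ.*-identityˡ s ⟨
  1ℚ *ℚ s                            ≤⟨ ℚ.*-monoʳ-≤-nonNeg s {{ℚ.nonNegative s≥0}} one≤four ⟩
  ℕtoℚ 4 *ℚ s                        ≡⟨ cong (_*ℚ s) half·8≡4 ⟨
  (((+ 1) / 2) *ℚ ℕtoℚ 8) *ℚ s       ≡⟨ ℚ.*-assoc ((+ 1) / 2) (ℕtoℚ 8) s ⟩
  ((+ 1) / 2) *ℚ (ℕtoℚ 8 *ℚ s)       ≡⟨ cong (((+ 1) / 2) *ℚ_) (ℚ.*-comm (ℕtoℚ 8) s) ⟩
  ((+ 1) / 2) *ℚ (s *ℚ ℕtoℚ 8)       ≤⟨ ℚ.*-monoˡ-≤-nonNeg ((+ 1) / 2) s8≤ε ⟩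
  ((+ 1) / 2) *ℚ ε                   ∎
  where
  open ℚ.≤-Reasoning
  one≤four : 1ℚ ≤ℚ ℕtoℚ 4
  one≤four = ℚ.*≤* (ℤ.+≤+ (s≤s z≤n))
  half·8≡4 : ((+ 1) / 2) *ℚ ℕtoℚ 8 ≡ ℕtoℚ 4
  half·8≡4 = refl
  s8≤ε : s *ℚ ℕtoℚ 8 ≤ℚ ε
  s8≤ε = ℚ.*-cancelʳ-≤-pos m {{ℚ.positive m>0}} (begin
    (s *ℚ ℕtoℚ 8) *ℚ m    ≡⟨ ℚ.*-assoc s (ℕtoℚ 8) m ⟩
    s *ℚ (ℕtoℚ 8 *ℚ m)    ≤⟨ s8m≤mε ⟩
    m *ℚ ε                ≡⟨ ℚ.*-comm m ε ⟩
    ε *ℚ m                ∎)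

square-nonNeg : ∀ x → 0ℚ ≤ℚ x *ℚ x
square-nonNeg x with ℚ.≤-total 0ℚ x
... | inj₁ x≥0 = ℚ.nonNegative⁻¹ _ {{ℚ.nonNeg*nonNeg⇒nonNeg x {{ℚ.nonNegative x≥0}} x {{ℚ.nonNegative x≥0}}}}
... | inj₂ x≤0 = ℚ.nonNegative⁻¹ _ {{ℚ.nonPos*nonPos⇒nonPos x {{ℚ.nonPositive x≤0}} x {{ℚ.nonPositive x≤0}}}}

sumℚ-nonNeg : ∀ {xs} → All (0ℚ ≤ℚ_) xs → 0ℚ ≤ℚ sumℚ xs
sumℚ-nonNeg []           = ℚ.≤-refl
sumℚ-nonNeg (x≥0 ∷ xs≥0) = ℚ.+-mono-≤ x≥0 (sumℚ-nonNeg xs≥0)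

Inf-nonNeg : ∀ {n} (f : Cube n → ℚ) j → 0ℚ ≤ℚ Inf f j
Inf-nonNeg {n} f j = sumℚ-nonNeg (All.map⁺ (All.universal (λ T → square-nonNeg (fhat f T))
  (filterᵇ (meets ⁅ j ⁆) (allCube n))))

Is≥0 : ∀ {n} (f : Cube n → ℚ) Is → Is ↭ map (Inf f) (allFin n) → All (0ℚ ≤ℚ_) Is
Is≥0 {n} f Is perm = All-resp-↭ (↭-sym perm) (All.map⁺ (All.universal (Inf-nonNeg f) (allFin n)))

heavy-or-light : ∀ G → (∀ {a b} → a ≤ b → G b ≤ℚ G a) → ∀ K → 0ℚ ≤ℚ K → ∀ ε L →
                 (Σ ℕ λ ℓ → ℓ < L × ε ≤ℚ ℕtoℚ (2 ^ ℓ) *ℚ (G (blockStart ℓ) *ℚ K))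
                 ⊎ partialSum G (blockStart L) *ℚ K ≤ℚ ℕtoℚ L *ℚ ε
heavy-or-light G antitone K K≥0 ε L with ℕ.anyUpTo? (λ ℓ → ε ℚ.≤? ℕtoℚ (2 ^ ℓ) *ℚ (G (blockStart ℓ) *ℚ K)) L
... | yes heavy    = inj₁ heavy
... | no  noHeavy  = inj₂ (subst (_≤ℚ ℕtoℚ L *ℚ ε) (partialSum-scale G K (blockStart L))
                            (dyadic-blocks (λ i → G i *ℚ K) scaledAntitone ε L light))
  where
  scaledAntitone : ∀ {a b} → a ≤ b → G b *ℚ K ≤ℚ G a *ℚ K
  scaledAntitone a≤b = ℚ.*-monoʳ-≤-nonNeg K {{ℚ.nonNegative K≥0}} (antitone a≤b)
  light : ∀ ℓ → ℓ < L → ℕtoℚ (2 ^ ℓ) *ℚ (G (blockStart ℓ) *ℚ K) ≤ℚ ε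
  light ℓ ℓ<L = ℚ.<⇒≤ (ℚ.≰⇒> (λ heavy → noHeavy (ℓ , ℓ<L , heavy)))

ℚ-ring : AlmostCommutativeRing 0ℓ 0ℓ
ℚ-ring = fromCommutativeRing ℚ.+-*-commutativeRing (λ _ → nothing)

-- The weight of a heavy block, rewritten in the form used by InfAboveThreshold.
block-weight : ∀ ℓ t m → ℕtoℚ (2 ^ ℓ) *ℚ (t *ℚ (ℕtoℚ 8 *ℚ m)) ≡ (t *ℚ ℕtoℚ (2 ^ (ℓ + 3))) *ℚ m
block-weight ℓ t m = trans (reassociate (ℕtoℚ (2 ^ ℓ)) t (ℕtoℚ 8) m)
  (cong (λ x → (t *ℚ x) *ℚ m) (trans (sym (ℕtoℚ-* (2 ^ ℓ) 8)) (cong ℕtoℚ (sym (ℕ.^-distribˡ-+-* 2 ℓ 3)))))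
  where
  reassociate : ∀ a t e m → a *ℚ (t *ℚ (e *ℚ m)) ≡ (t *ℚ (a *ℚ e)) *ℚ m
  reassociate = solve-∀ ℚ-ring

influential-set : ∀ {n} (f : Cube n → ℚ) Is → Is ↭ map (Inf f) (allFin n) → Linked _≥ℚ_ Is →
                  ∀ i ℓ M N ε → 0ℚ <ℚ ε → 2 ^ M ≤ N →
                  ε ≤ℚ (Ith Is i *ℚ ℕtoℚ (2 ^ (ℓ + 3))) *ℚ ℕtoℚ M →
                  Σ (Subset n) λ J → (i ≤ ∣ J ∣) × (∀ j → j ∈ J → InfAboveThreshold (Inf f j) ℓ N ε)
influential-set {n} f Is perm sorted i ℓ M N ε ε>0 2^M≤N ε≤tCM = J , i≤∣J∣ , aboveThreshold
  where
  t = Ith Is i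
  C = ℕtoℚ (2 ^ (ℓ + 3))
  t>0 : 0ℚ <ℚ t
  t>0 = positive-factor (positive-factor ε>0 ε≤tCM (ℕtoℚ-nonNeg M)) ℚ.≤-refl (ℕtoℚ-nonNeg (2 ^ (ℓ + 3)))
  J : Subset n
  J = subsetWhere (λ j → t ℚ.≤? Inf f j)
  i≤∣J∣ : i ≤ ∣ J ∣
  i≤∣J∣ = begin
    i                                                      ≤⟨ count-above (t ℚ.≤?_) Is i sorted (Is≥0 f Is perm) t>0 ℚ.≤-refl ⟩
    length (filter (t ℚ.≤?_) Is)                           ≡⟨ ↭-length (filter-↭ (t ℚ.≤?_) perm) ⟩
    length (filter (t ℚ.≤?_) (map (Inf f) (allFin n)))     ≡⟨ ∣subsetWhere∣ (t ℚ.≤?_) n (Inf f) ⟨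
    ∣ J ∣                                                  ∎
    where open ℕ.≤-Reasoning
  aboveThreshold : ∀ j → j ∈ J → InfAboveThreshold (Inf f j) ℓ N ε
  aboveThreshold j j∈J = mulLogGe-intro (Inf f j *ℚ C) ε M N ε>0 (ℚ.≤-trans ε≤tCM
    (ℚ.*-monoʳ-≤-nonNeg (ℕtoℚ M) {{ℚ.nonNegative (ℕtoℚ-nonNeg M)}}
      (ℚ.*-monoʳ-≤-nonNeg C {{ℚ.nonNegative (ℕtoℚ-nonNeg (2 ^ (ℓ + 3)))}} (∈-subsetWhere (λ i → t ℚ.≤? Inf f i) j∈J)))) 2^M≤N

-- Index bookkeeping: the sequence I_{k+1}, I_{k+2}, … is indexed by i ↦ (k+1)+i, and
-- the start of the ℓ-th dyadic block of it is I_{k+2^ℓ}.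
shift-index : ∀ k i → (k + 1) + i ≡ suc (k + i)
shift-index k i = trans (ℕ.+-assoc k 1 i) (ℕ.+-suc k i)

blockStart-index : ∀ k ℓ → (k + 1) + blockStart ℓ ≡ k + 2 ^ ℓ
blockStart-index k ℓ = trans (shift-index k (blockStart ℓ))
  (trans (sym (ℕ.+-suc k (blockStart ℓ))) (cong (λ x → k + x) (ℕ.m+[n∸m]≡n (ℕ.m^n>0 2 ℓ))))

HeavyBlock : List ℚ → ℕ → ℕ → ℚ → Set
HeavyBlock Is k m ε = Σ ℕ λ ℓ → ℓ < suc m × ε ≤ℚ (Ith Is (k + 2 ^ ℓ) *ℚ ℕtoℚ (2 ^ (ℓ + 3))) *ℚ ℕtoℚ (suc m)

LightTail : List ℚ → ℕ → ℕ → ℚ → Set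
LightTail Is k m ε = ∀ a → a ≤ blockStart (suc m) → partialSum (λ i → Ith Is ((k + 1) + i)) a ≤ℚ ((+ 1) / 2) *ℚ ε

tail-dichotomy : ∀ Is → Linked _≥ℚ_ Is → All (0ℚ ≤ℚ_) Is → ∀ k m ε → HeavyBlock Is k m ε ⊎ LightTail Is k m ε
tail-dichotomy Is sorted Is≥0 k m ε = Sum.map heavyBlock lightBlocks (heavy-or-light G G-antitone K K≥0 ε (suc m))
  where
  G : ℕ → ℚ
  G i = Ith Is ((k + 1) + i)
  G≥0 : ∀ i → 0ℚ ≤ℚ G i
  G≥0 i = Ith-nonNeg Is≥0 ((k + 1) + i)
  G-antitone : ∀ {a b} → a ≤ b → G b ≤ℚ G a
  G-antitone {a} {b} a≤b = subst₂ _≤ℚ_ (cong (Ith Is) (sym (shift-index k b))) (cong (Ith Is) (sym (shift-index k a)))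
    (Ith-antitone sorted Is≥0 (ℕ.+-monoʳ-≤ k a≤b))
  K : ℚ
  K = ℕtoℚ 8 *ℚ ℕtoℚ (suc m)
  K≥0 : 0ℚ ≤ℚ K
  K≥0 = ℚ.nonNegative⁻¹ K {{ℚ.nonNeg*nonNeg⇒nonNeg (ℕtoℚ 8) {{ℚ.nonNegative (ℕtoℚ-nonNeg 8)}}
                                                   (ℕtoℚ (suc m)) {{ℚ.nonNegative (ℕtoℚ-nonNeg (suc m))}}}}
  heavyBlock : (Σ ℕ λ ℓ → ℓ < suc m × ε ≤ℚ ℕtoℚ (2 ^ ℓ) *ℚ (G (blockStart ℓ) *ℚ K)) → HeavyBlock Is k m ε
  heavyBlock (ℓ , ℓ<M , heavy) = ℓ , ℓ<M ,
    subst (λ i → ε ≤ℚ (Ith Is i *ℚ ℕtoℚ (2 ^ (ℓ + 3))) *ℚ ℕtoℚ (suc m)) (blockStart-index k ℓ)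
      (subst (ε ≤ℚ_) (block-weight ℓ (G (blockStart ℓ)) (ℕtoℚ (suc m))) heavy)
  lightBlocks : partialSum G (blockStart (suc m)) *ℚ K ≤ℚ ℕtoℚ (suc m) *ℚ ε → LightTail Is k m ε
  lightBlocks light a a≤ = ℚ.≤-trans (partialSum-mono G G≥0 a≤)
    (eighth⇒half (ℕtoℚ-pos m) (partialSum-nonNeg G G≥0 (blockStart (suc m))) light)

-- With M = ⌊log₂ 200k⌋ + 1, the M dyadic blocks cover the indices k+1, …, 200k ...
blocks-cover : ∀ k → suc (200 * k) ∸ (k + 1) ≤ blockStart (suc ⌊log₂ (200 * k) ⌋)
blocks-cover k = ℕ.≤-trans (ℕ.∸-monoʳ-≤ (suc (200 * k)) (ℕ.m≤n+m 1 k)) (ℕ.∸-monoˡ-≤ 1 (log₂-upper (200 * k)))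

-- ... and M ≤ log₂ 400k.
blocks-count : ∀ k → 1 ≤ k → 2 ^ suc ⌊log₂ (200 * k) ⌋ ≤ 400 * k
blocks-count k k≥1 = ℕ.≤-trans (ℕ.*-monoʳ-≤ 2 (log₂-lower (200 * k) (ℕ.*-mono-≤ {1} {200} (s≤s z≤n) k≥1)))
                               (ℕ.≤-reflexive (sym (ℕ.*-assoc 2 200 k)))

tailSum : ℕ → List ℚ → ℚ
tailSum k Is = sumFromTo (k + 1) (200 * k) (Ith Is)

ManyAboveThreshold : ∀ {n} → (Cube n → ℚ) → ℕ → ℚ → Set
ManyAboveThreshold {n} f k ε = Σ ℕ (λ ℓ → (ℓ ≤ ⌊log₂ (200 * k) ⌋) ×
  Σ (Subset n) (λ J → (k + 2 ^ ℓ ≤ ∣ J ∣) × (∀ j → j ∈ J → InfAboveThreshold (Inf f j) ℓ (400 * k) ε)))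

-- If the blocks are light, the sum of I_{k+1}, …, I_{200k}
-- is at most ε/2 (alternative 2).  Otherwise a heavy block ℓ ≤ m yields k + 2^ℓ variables
-- above the threshold, and alternative 1 holds unless the sum is ≤ ε/2 anyway.
lemma4p3 : (n k : ℕ) → 1 ≤ k → (ε : ℚ) → 0ℚ <ℚ ε → ε <ℚ 1ℚ →
    (f : Cube n → ℚ) → (∀ x → (f x ≡ 1ℚ) ⊎ (f x ≡ - 1ℚ)) →
    FarFromJuntas ε k f →
    (Is : List ℚ) → Is ↭ map (Inf f) (allFin n) → Linked _≥ℚ_ Is →
    ((((+ 1) / 2) *ℚ ε ≤ℚ sumFromTo (k + 1) (200 * k) (Ith Is))
      × Σ ℕ (λ ℓ → (ℓ ≤ ⌊log₂ (200 * k) ⌋) ×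
          Σ (Subset n) (λ J → (k + 2 ^ ℓ ≤ ∣ J ∣) ×
            (∀ j → j ∈ J → InfAboveThreshold (Inf f j) ℓ (400 * k) ε))))
    ⊎ (sumFromTo (k + 1) (200 * k) (Ith Is) ≤ℚ ((+ 1) / 2) *ℚ ε)
lemma4p3 n k k≥1 ε ε>0 _ f _ _ Is perm sorted =
  conclude (tailSum k Is ℚ.≤? ((+ 1) / 2) *ℚ ε) (tail-dichotomy Is sorted (Is≥0 f Is perm) k m ε)
  where
  m : ℕ
  m = ⌊log₂ (200 * k) ⌋
  conclude : Dec (tailSum k Is ≤ℚ ((+ 1) / 2) *ℚ ε) → HeavyBlock Is k m ε ⊎ LightTail Is k m ε →
    (((+ 1) / 2) *ℚ ε ≤ℚ tailSum k Is × ManyAboveThreshold f k ε) ⊎ (tailSum k Is ≤ℚ ((+ 1) / 2) *ℚ ε)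
  conclude (yes small) _                            = inj₂ small
  conclude (no _)      (inj₂ light)                 = inj₂ (light (suc (200 * k) ∸ (k + 1)) (blocks-cover k))
  conclude (no large)  (inj₁ (ℓ , ℓ<M , heavy))     = inj₁ (ℚ.<⇒≤ (ℚ.≰⇒> large) , ℓ , ℕ.s≤s⁻¹ ℓ<M ,
    influential-set f Is perm sorted (k + 2 ^ ℓ) ℓ (suc m) (400 * k) ε ε>0 (blocks-count k k≥1) heavy)
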